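{- Let $A=(a_{ij})$ be a graph of order $n$ and $\hat A=(\hat a_{ij})$ its stable graph. Then (1) $\hat A$ recognizes vertices, i.e. no diagonal entry of $\hat A$ equals an off-diagonal entry (in particular $\hat a_{uu}\ne\hat a_{uv}$ for $u\ne v$); (2) $\hat A$ recognizes the edges of $A$: for all $u,v,r,s\in[n]$, if $a_{uv}\ne x_0$ and $a_{rs}=x_0$ then $\hat a_{uv}\ne\hat a_{rs}$.
   Context: Labels are independent commuting indeterminates $x_0,x_1,\dots$; $\mathrm{Var}=\{x_1,x_2,\dots\}$. A graph of order $n$ is a symmetric $n\times n$ matrix over $\{x_0\}\cup\mathrm{Var}$; $\dim$ is its number of distinct entries. Products and powers ($A^0=I$) are computed in the commutative polynomial ring over $\mathbb{R}$ in the indeterminates and an extra indeterminate $\lambda$. $G\approx H$ means $g_{ij}=g_{st}\iff h_{ij}=h_{st}$ for all $i,j,s,t$. An equivalent variable substitution replaces the entries of a matrix by variables of $\mathrm{Var}$, equal entries by equal variables and distinct by distinct. Description graph $\tilde G$: obtained from $\Gamma(G)=\sum_{k=0}^{n-1}\lambda^kG^k$ by an equivalent variable substitution. Stable graph $\hat A$: $A_0=A$, $A_{k+1}=\tilde{A_k}$, $\hat A:=A_t$ for the first $t$ with $\dim(A_t)=\dim(A_{t+1})$ (defined up to $\approx$). -}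

module Defs where

open import Data.Nat using (ℕ; zero; suc; _≤_; _<_; _≟_)
open import Data.Fin using (Fin)
import Data.Fin as F
open import Data.List.Base using (List; []; _∷_; _++_; concatMap; map; replicate; allFin; upTo; length; deduplicate; [_])
open import Data.Product using (_×_)
open import Function.Bundles using (_⇔_)
open import Relation.Nullary using (¬_)
open import Relation.Binary.PropositionalEquality using (_≡_; _≢_)
import Data.List.Relation.Binary.Permutation.Propositional as PermP
import Data.List.Relation.Binary.Permutation.Setoid as PermS

-- Labels: the label x_k is encoded by the natural number k.
-- x_0 is encoded by 0, Var = {x_1, x_2, ...} by the positive naturals.

Label : Set
Label = ℕ

Mat : Set → ℕ → Set
Mat A n = Fin n → Fin n → A

IsGraph : ∀ {n} → Mat Label n → Set
IsGraph {n} G = ∀ (i j : Fin n) → G i j ≡ G j i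

-- Commutative polynomials with natural-number coefficients in the
-- indeterminates x_0, x_1, ... and λ.  (All matrices appearing have
-- entries that are sums of products of indeterminates, so their
-- coefficients are natural numbers; equality in ℝ[x_0,x_1,...,λ] of such
-- polynomials is equality of these multisets.)

data Ind : Set where
  lam : Ind
  var : ℕ → Ind

-- A monomial is a finite multiset of indeterminates (a list up to
-- permutation); a polynomial with ℕ coefficients is a finite multiset of
-- monomials (coefficient = multiplicity).
Mono : Set
Mono = List Ind

Poly : Set
Poly = List Mono

_≃ₚ_ : Poly → Poly → Set
p ≃ₚ q = PermS._↭_ PermP.↭-setoid p q

0ₚ : Poly
0ₚ = []

1ₚ : Poly
1ₚ = [ [] ]

_+ₚ_ : Poly → Poly → Poly
p +ₚ q = p ++ q

_*ₚ_ : Poly → Poly → Poly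
p *ₚ q = concatMap (λ m → map (λ m' → m ++ m') q) p

λ^ : ℕ → Poly
λ^ k = [ replicate k lam ]

Σₚ : ∀ {A : Set} → List A → (A → Poly) → Poly
Σₚ xs f = concatMap f xs

PMat : ℕ → Set
PMat n = Mat Poly n

idP : ∀ {n} → PMat n
idP i j with F._≟_ i j
... | Relation.Nullary.yes _ = 1ₚ
... | Relation.Nullary.no _ = 0ₚ

_⊗_ : ∀ {n} → PMat n → PMat n → PMat n
_⊗_ {n} P Q i j = Σₚ (allFin n) (λ k → P i k *ₚ Q k j)

_^ₘ_ : ∀ {n} → PMat n → ℕ → PMat n
P ^ₘ zero = idP
P ^ₘ suc k = P ⊗ (P ^ₘ k)

toPMat : ∀ {n} → Mat Label n → PMat n
toPMat G i j = [ [ var (G i j) ] ]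

Γ : ∀ {n} → Mat Label n → PMat n
Γ {n} G i j = Σₚ (upTo n) (λ k → λ^ k *ₚ ((toPMat G ^ₘ k) i j))

entries : ∀ {n} → Mat Label n → List Label
entries {n} G = concatMap (λ i → map (λ j → G i j) (allFin n)) (allFin n)

dim : ∀ {n} → Mat Label n → ℕ
dim G = length (deduplicate _≟_ (entries G))

-- H is a description graph of G: H arises from Γ(G) by an equivalent
-- variable substitution (entries of H lie in Var, equal entries of Γ(G)
-- get equal variables, distinct entries distinct variables).

IsDescription : ∀ {n} → Mat Label n → Mat Label n → Set
IsDescription {n} G H =
  (∀ (i j : Fin n) → H i j ≢ 0) ×
  (∀ (i j s t : Fin n) → (H i j ≡ H s t) ⇔ (Γ G i j ≃ₚ Γ G s t))

IsStableGraph : ∀ {n} → Mat Label n → Mat Label n → Set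
IsStableGraph {n} A S =
  Data.Product.Σ (ℕ → Mat Label n) λ seq →
  Data.Product.Σ ℕ λ t →
    (∀ i j → seq 0 i j ≡ A i j) ×
    (∀ k → k ≤ t → IsDescription (seq k) (seq (suc k))) ×
    (dim (seq t) ≡ dim (seq (suc t))) ×
    (∀ k → k < t → dim (seq k) ≢ dim (seq (suc k))) ×
    (∀ i j → S i j ≡ seq t i j)

-- Γ(G)ᵢⱼ contains the constant monomial 1 exactly when i = j (it can only come from the
-- term λ⁰G⁰ = I), and, when n ≥ 2, it contains λxₐ exactly when gᵢⱼ = xₐ (this can only
-- come from the term λG). So a description graph refines its graph and separates the
-- diagonal from the off-diagonal cells. Iterating, every graph of the sequence refines A,
-- which gives (2). A refinement that splits a class strictly increases dim, so at the
-- stable index t the refinement A_t → A_{t+1} splits nothing; since A_{t+1} separates the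
-- diagonal, so does A_t, which gives (1).
module Submission where

open import Defs
open import Data.Nat using (ℕ; zero; suc; _+_; _≤_; _<_; z≤n; s≤s; _≟_)
open import Data.Nat.Properties using (≤-refl; <⇒≤; +-suc; +-monoʳ-≤; <⇒≢; m<n⇒m<1+n; module ≤-Reasoning)
open import Data.Fin using (Fin)
import Data.Fin as F
open import Data.Product using (_×_; _,_; proj₁; proj₂; ∃-syntax; uncurry)
open import Data.List.Base using (List; []; _∷_; _++_; [_]; map; filter; length; deduplicate;
  replicate; allFin; upTo; concatMap; cartesianProduct)
open import Data.List.Properties using (filter-accept; filter-reject; filter-all; length-filter; map-++; map-∘)
open import Data.List.Relation.Unary.Any using (Any; here; there)
import Data.List.Relation.Unary.Any as Any
open import Data.List.Relation.Unary.Any.Properties using (map⁺; map⁻; ++⁺ˡ; ++⁻; concatMap⁺; concatMap⁻)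
open import Data.List.Relation.Unary.All.Properties using (¬Any⇒All¬; All¬⇒¬Any)
open import Data.List.Relation.Unary.AllPairs using (_∷_)
open import Data.List.Relation.Unary.Unique.Propositional using (Unique)
open import Data.List.Relation.Unary.Unique.DecPropositional.Properties using (deduplicate-!)
open import Data.List.Membership.Propositional using (_∈_; _∉_)
open import Data.List.Membership.Propositional.Properties
  using (∈-allFin; ∈-map⁺; ∈-map⁻; ∈-deduplicate⁺; ∈-deduplicate⁻; ∈-cartesianProduct⁺)
open import Data.List.Membership.DecPropositional _≟_ using (_∈?_)
open import Data.List.Relation.Binary.Permutation.Propositional using (_↭_; ↭-refl; ↭-sym; ↭-trans; ↭-setoid)
open import Data.List.Relation.Binary.Permutation.Propositional.Properties using (drop-∷; ↭-singleton-inv; ¬x∷xs↭[])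
import Data.List.Relation.Binary.Permutation.Setoid.Properties as Perm
open import Data.Sum using (inj₁; inj₂)
open import Data.Empty using (⊥-elim)
open import Function using (_∘_)
open import Function.Bundles using (Equivalence)
open import Relation.Nullary using (yes; no; ¬?)
open import Relation.Binary.PropositionalEquality using (_≡_; _≢_; refl; sym; trans; cong; cong₂; subst₂; module ≡-Reasoning)

distinct : List ℕ → ℕ
distinct xs = length (deduplicate _≟_ xs)

length-filter-≢ : ∀ {x} {ys : List ℕ} → Unique ys → x ∈ ys →
  suc (length (filter (¬? ∘ (x ≟_)) ys)) ≡ length ys
length-filter-≢ {x} (x∉ys ∷ _) (here refl) = cong (suc ∘ length)
  (trans (filter-reject (¬? ∘ (x ≟_)) (λ x≢x → x≢x refl)) (filter-all (¬? ∘ (x ≟_)) x∉ys))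
length-filter-≢ {x} {y ∷ ys} (y∉ys ∷ unique) (there x∈ys) = trans
  (cong (suc ∘ length) (filter-accept (¬? ∘ (x ≟_)) λ { refl → All¬⇒¬Any y∉ys x∈ys }))
  (cong suc (length-filter-≢ unique x∈ys))

distinct-∷-∈ : ∀ {x xs} → x ∈ xs → distinct (x ∷ xs) ≡ distinct xs
distinct-∷-∈ {x} {xs} x∈xs = length-filter-≢ (deduplicate-! _≟_ xs) (∈-deduplicate⁺ _≟_ x∈xs)

distinct-∷-∉ : ∀ {x xs} → x ∉ xs → distinct (x ∷ xs) ≡ suc (distinct xs)
distinct-∷-∉ {x} {xs} x∉xs = cong (suc ∘ length)
  (filter-all (¬? ∘ (x ≟_)) (¬Any⇒All¬ _ (x∉xs ∘ ∈-deduplicate⁻ _≟_ xs)))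

distinct-∷-≤ : ∀ x xs → distinct (x ∷ xs) ≤ suc (distinct xs)
distinct-∷-≤ x xs = s≤s (length-filter (¬? ∘ (x ≟_)) (deduplicate _≟_ xs))

module _ {I : Set} (f g : I → ℕ) (g-refines-f : ∀ p q → g p ≡ g q → f p ≡ f q) where

  ∈-map-refined : ∀ {x L} → g x ∈ map g L → f x ∈ map f L
  ∈-map-refined gx∈gL with ∈-map⁻ g gx∈gL
  ... | r , r∈L , gx≡gr = subst₂ _∈_ (sym (g-refines-f _ r gx≡gr)) refl (∈-map⁺ f r∈L)

  -- With k = 1 this is the step for <, since m < n unfolds to suc m ≤ n.
  distinct-map-∷ : ∀ {k} x L → k + distinct (map f L) ≤ distinct (map g L) →
    k + distinct (map f (x ∷ L)) ≤ distinct (map g (x ∷ L))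
  distinct-map-∷ {k} x L le with g x ∈? map g L
  ... | yes gx∈ = begin
    k + distinct (f x ∷ map f L) ≡⟨ cong (k +_) (distinct-∷-∈ (∈-map-refined gx∈)) ⟩
    k + distinct (map f L)       ≤⟨ le ⟩
    distinct (map g L)           ≡⟨ sym (distinct-∷-∈ gx∈) ⟩
    distinct (g x ∷ map g L)     ∎
    where open ≤-Reasoning
  ... | no gx∉ = begin
    k + distinct (f x ∷ map f L)   ≤⟨ +-monoʳ-≤ k (distinct-∷-≤ (f x) (map f L)) ⟩
    k + suc (distinct (map f L))   ≡⟨ +-suc k _ ⟩
    suc (k + distinct (map f L))   ≤⟨ s≤s le ⟩
    suc (distinct (map g L))       ≡⟨ sym (distinct-∷-∉ gx∉) ⟩
    distinct (g x ∷ map g L)       ∎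
    where open ≤-Reasoning

  distinct-map-mono : ∀ L → distinct (map f L) ≤ distinct (map g L)
  distinct-map-mono []      = z≤n
  distinct-map-mono (x ∷ L) = distinct-map-∷ {0} x L (distinct-map-mono L)

  distinct-map-< : ∀ L {p q} → p ∈ L → q ∈ L → f p ≡ f q → g p ≢ g q →
    distinct (map f L) < distinct (map g L)
  distinct-map-<-head : ∀ x L {q} → q ∈ L → f x ≡ f q → g x ≢ g q →
    distinct (map f (x ∷ L)) < distinct (map g (x ∷ L))

  distinct-map-< (x ∷ L) (here refl)  (here refl)  _   gp≢gq = ⊥-elim (gp≢gq refl)
  distinct-map-< (x ∷ L) (here refl)  (there q∈L)  f≡ g≢ = distinct-map-<-head x L q∈L f≡ g≢
  distinct-map-< (x ∷ L) (there p∈L)  (here refl)  f≡ g≢ = distinct-map-<-head x L p∈L (sym f≡) (g≢ ∘ sym)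
  distinct-map-< (x ∷ L) (there p∈L)  (there q∈L)  f≡ g≢ =
    distinct-map-∷ {1} x L (distinct-map-< L p∈L q∈L f≡ g≢)

  -- If g x is already taken in L by some r, the split pair (x, q) is traded for (r, q) in L.
  distinct-map-<-head x L {q} q∈L fx≡fq gx≢gq with g x ∈? map g L
  ... | yes gx∈ with ∈-map⁻ g gx∈
  ...   | r , r∈L , gx≡gr = distinct-map-∷ {1} x L (distinct-map-< L r∈L q∈L
          (trans (sym (g-refines-f x r gx≡gr)) fx≡fq) (gx≢gq ∘ trans gx≡gr))
  distinct-map-<-head x L {q} q∈L fx≡fq gx≢gq | no gx∉ = begin-strict
    distinct (f x ∷ map f L)   ≡⟨ distinct-∷-∈ (subst₂ _∈_ (sym fx≡fq) refl (∈-map⁺ f q∈L)) ⟩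
    distinct (map f L)         <⟨ s≤s (distinct-map-mono L) ⟩
    suc (distinct (map g L))   ≡⟨ sym (distinct-∷-∉ gx∉) ⟩
    distinct (g x ∷ map g L)   ∎
    where open ≤-Reasoning

Refines : ∀ {n} → Mat Label n → Mat Label n → Set
Refines {n} H G = ∀ (i j s t : Fin n) → H i j ≡ H s t → G i j ≡ G s t

cells : ∀ n → List (Fin n × Fin n)
cells n = cartesianProduct (allFin n) (allFin n)

map-uncurry-cartesianProduct : ∀ {A B C : Set} (f : A → B → C) xs ys →
  map (uncurry f) (cartesianProduct xs ys) ≡ concatMap (λ x → map (f x) ys) xs
map-uncurry-cartesianProduct f []       ys = refl
map-uncurry-cartesianProduct f (x ∷ xs) ys = begin
  map (uncurry f) (map (x ,_) ys ++ cartesianProduct xs ys)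
    ≡⟨ map-++ (uncurry f) (map (x ,_) ys) _ ⟩
  map (uncurry f) (map (x ,_) ys) ++ map (uncurry f) (cartesianProduct xs ys)
    ≡⟨ cong₂ _++_ (sym (map-∘ ys)) (map-uncurry-cartesianProduct f xs ys) ⟩
  map (f x) ys ++ concatMap (λ x → map (f x) ys) xs
    ∎
  where open ≡-Reasoning

dim-< : ∀ {n} {G H : Mat Label n} → Refines H G → ∀ {i j s t} →
  G i j ≡ G s t → H i j ≢ H s t → dim G < dim H
dim-< {n} {G} {H} H≼G {i} {j} {s} {t} G≡ H≢ = subst₂ _<_
  (cong distinct (map-uncurry-cartesianProduct G (allFin n) (allFin n)))
  (cong distinct (map-uncurry-cartesianProduct H (allFin n) (allFin n)))
  (distinct-map-< (uncurry G) (uncurry H) (λ (i , j) (s , t) → H≼G i j s t) (cells n)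
    (∈-cartesianProduct⁺ (∈-allFin i) (∈-allFin j)) (∈-cartesianProduct⁺ (∈-allFin s) (∈-allFin t)) G≡ H≢)

_∈ₚ_ : Mono → Poly → Set
m ∈ₚ p = Any (_↭ m) p

∈ₚ-resp-≃ₚ : ∀ {m p q} → m ∈ₚ p → p ≃ₚ q → m ∈ₚ q
∈ₚ-resp-≃ₚ m∈p p≃q = Perm.Any-resp-↭ ↭-setoid (λ m₁↭m₂ m₁↭m → ↭-trans (↭-sym m₁↭m₂) m₁↭m) p≃q m∈p

private variable
  P : Mono → Set

Any-monomial*ₚ⁺ : ∀ {m X} → Any (P ∘ (m ++_)) X → Any P ([ m ] *ₚ X)
Any-monomial*ₚ⁺ = ++⁺ˡ ∘ map⁺

Any-monomial*ₚ⁻ : ∀ {m X} → Any P ([ m ] *ₚ X) → Any (P ∘ (m ++_)) X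
Any-monomial*ₚ⁻ {m = m} {X = X} p with ++⁻ (map (m ++_) X) p
... | inj₁ q = map⁻ q
... | inj₂ ()

Any-Σₚ⁺ : ∀ {A : Set} {xs : List A} {f : A → Poly} {x} → x ∈ xs → Any P (f x) → Any P (Σₚ xs f)
Any-Σₚ⁺ {f = f} x∈xs p = concatMap⁺ f (Any.map (λ { refl → p }) x∈xs)

Any-Σₚ⁻ : ∀ {A : Set} {xs : List A} {f : A → Poly} → Any P (Σₚ xs f) → ∃[ x ] Any P (f x)
Any-Σₚ⁻ {xs = xs} {f = f} p = Any.satisfied (concatMap⁻ f {xs = xs} p)

idP-diag : ∀ {n} (i : Fin n) → idP i i ≡ 1ₚ
idP-diag i with i F.≟ i
... | yes _   = refl
... | no i≢i = ⊥-elim (i≢i refl)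

Any-idP⁺ : ∀ {n} (i : Fin n) → P [] → Any P (idP i i)
Any-idP⁺ i P[] rewrite idP-diag i = here P[]

Any-idP⁻ : ∀ {n} (i j : Fin n) → Any P (idP i j) → i ≡ j × P []
Any-idP⁻ i j p with i F.≟ j
Any-idP⁻ i j (here P[]) | yes i≡j = i≡j , P[]
Any-idP⁻ i j (there ()) | yes _
Any-idP⁻ i j ()         | no _

module _ {n} (G : Mat Label n) (i j : Fin n) where

  Any-^1⁺ : P [ var (G i j) ] → Any P ((toPMat G ^ₘ 1) i j)
  Any-^1⁺ P[x] = Any-Σₚ⁺ (∈-allFin j) (Any-monomial*ₚ⁺ (Any-idP⁺ j P[x]))

  Any-^1⁻ : Any P ((toPMat G ^ₘ 1) i j) → P [ var (G i j) ]
  Any-^1⁻ p with Any-Σₚ⁻ {xs = allFin n} p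
  ... | l , q with Any-idP⁻ l j (Any-monomial*ₚ⁻ q)
  ...   | refl , P[x] = P[x]

  Any-Γ⁺ : ∀ {k} → k ∈ upTo n → Any (P ∘ (replicate k lam ++_)) ((toPMat G ^ₘ k) i j) → Any P (Γ G i j)
  Any-Γ⁺ k∈ p = Any-Σₚ⁺ k∈ (Any-monomial*ₚ⁺ p)

  Any-Γ⁻ : Any P (Γ G i j) → ∃[ k ] Any (P ∘ (replicate k lam ++_)) ((toPMat G ^ₘ k) i j)
  Any-Γ⁻ p with Any-Σₚ⁻ {xs = upTo n} p
  ... | k , q = k , Any-monomial*ₚ⁻ q

Γ-unit : ∀ {n} (G : Mat Label n) (i : Fin n) → [] ∈ₚ Γ G i i
Γ-unit {suc n} G i = Any-Γ⁺ G i i (here refl) (Any-idP⁺ i ↭-refl)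

Γ-unit⇒≡ : ∀ {n} (G : Mat Label n) (i j : Fin n) → [] ∈ₚ Γ G i j → i ≡ j
Γ-unit⇒≡ G i j p with Any-Γ⁻ G i j p
... | zero  , q = proj₁ (Any-idP⁻ i j q)
... | suc _ , q = ⊥-elim (¬x∷xs↭[] (proj₂ (Any.satisfied q)))

Γ-λx : ∀ {n} (G : Mat Label (suc (suc n))) (i j : Fin (suc (suc n))) →
  (lam ∷ var (G i j) ∷ []) ∈ₚ Γ G i j
Γ-λx G i j = Any-Γ⁺ G i j (there (here refl)) (Any-^1⁺ G i j ↭-refl)

Γ-λx⇒≡ : ∀ {n} (G : Mat Label n) (i j : Fin n) {a} → (lam ∷ var a ∷ []) ∈ₚ Γ G i j → G i j ≡ a
Γ-λx⇒≡ G i j p with Any-Γ⁻ G i j p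
... | zero , q = ⊥-elim (¬x∷xs↭[] (↭-sym (proj₂ (Any-idP⁻ i j q))))
... | suc zero , q with ↭-singleton-inv (drop-∷ (Any-^1⁻ G i j q))
...   | refl = refl
Γ-λx⇒≡ G i j p | suc (suc _) , q with ↭-singleton-inv (drop-∷ (proj₂ (Any.satisfied q)))
...   | ()

description-separates-diagonal : ∀ {n} {G H : Mat Label n} → IsDescription G H →
  ∀ (u v w : Fin n) → v ≢ w → H u u ≢ H v w
description-separates-diagonal {G = G} (_ , desc) u v w v≢w Huu≡Hvw =
  v≢w (Γ-unit⇒≡ G v w (∈ₚ-resp-≃ₚ (Γ-unit G u) (Equivalence.to (desc u u v w) Huu≡Hvw)))

-- For n = 1 there is no λ-term in Γ, but then there is only one cell.
description-refines : ∀ {n} {G H : Mat Label n} → IsDescription G H → Refines H G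
description-refines {suc zero}    _ F.zero F.zero F.zero F.zero _ = refl
description-refines {suc (suc n)} {G} (_ , desc) i j s t Hij≡Hst =
  sym (Γ-λx⇒≡ G s t (∈ₚ-resp-≃ₚ (Γ-λx G i j) (Equivalence.to (desc i j s t) Hij≡Hst)))

descriptions-refine : ∀ {n} (seq : ℕ → Mat Label n) t →
  (∀ k → k < t → IsDescription (seq k) (seq (suc k))) → Refines (seq t) (seq 0)
descriptions-refine seq zero    _    i j s r e = e
descriptions-refine seq (suc t) desc i j s r e =
  descriptions-refine seq t (λ k k<t → desc k (m<n⇒m<1+n k<t))
    i j s r (description-refines (desc t ≤-refl) i j s r e)

proposition4 : ∀ (n : ℕ) (A S : Mat Label n) → IsGraph A → IsStableGraph A S →
    (∀ (u v w : Fin n) → v ≢ w → S u u ≢ S v w) ×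
    (∀ (u v r s : Fin n) → A u v ≢ 0 → A r s ≡ 0 → S u v ≢ S r s)
proposition4 n A S _ (seq , t , seq0≡A , desc , dim-stable , _ , S≡seqt) = vertices , edges
  where
  vertices : ∀ (u v w : Fin n) → v ≢ w → S u u ≢ S v w
  vertices u v w v≢w Suu≡Svw = <⇒≢
    (dim-< (description-refines (desc t ≤-refl))
      (trans (sym (S≡seqt u u)) (trans Suu≡Svw (S≡seqt v w)))
      (description-separates-diagonal (desc t ≤-refl) u v w v≢w))
    dim-stable

  edges : ∀ (u v r s : Fin n) → A u v ≢ 0 → A r s ≡ 0 → S u v ≢ S r s
  edges u v r s Auv≢0 Ars≡0 Suv≡Srs = Auv≢0 (begin
    A u v     ≡⟨ sym (seq0≡A u v) ⟩
    seq 0 u v ≡⟨ descriptions-refine seq t (λ k k<t → desc k (<⇒≤ k<t)) u v r s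
                   (trans (sym (S≡seqt u v)) (trans Suv≡Srs (S≡seqt r s))) ⟩
    seq 0 r s ≡⟨ seq0≡A r s ⟩
    A r s     ≡⟨ Ars≡0 ⟩
    0         ∎)
    where open ≡-Reasoning
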